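{- For every finite simple undirected graph $G$ and every coloring $c$ of $G$, $\gamma(G)\leq \gamma_{uc}(G,c)\leq \chi(\overline{G})$, where $\overline{G}$ is the complement of $G$.
   Context: A coloring of $G=(V,E)$ is a map $c:V\to\{0,1,2,\dots\}$ with $c(u)\neq c(v)$ whenever $u,v$ are adjacent. Given $(G,c)$, a set $D\subseteq V$ is an up--color dominating $c$--set if (1) every vertex $v\notin D$ has a neighbor $d\in D$ with $c(v)<c(d)$, and (2) $D$ contains no vertex of color $0$. $\gamma_{uc}(G,c)$ is the minimum cardinality of an up--color dominating $c$--set. $\gamma(G)$ is the domination number and $\chi$ the chromatic number. -}

module Defs where

open import Data.Nat using (ℕ; _≤_; _<_)
open import Data.Fin using (Fin)
open import Data.Fin.Subset using (Subset; _∈_; _∉_; ∣_∣)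
open import Data.Product using (Σ; ∃; _×_; _,_)
open import Relation.Nullary using (¬_)
open import Relation.Binary.PropositionalEquality using (_≡_; _≢_)

record Graph (n : ℕ) : Set₁ where
  field
    Adj       : Fin n → Fin n → Set
    sym       : ∀ {u v} → Adj u v → Adj v u
    irrefl    : ∀ {v} → ¬ Adj v v

open Graph public

complement : ∀ {n} → Graph n → Graph n
complement G = record
  { Adj    = λ u v → (u ≢ v) × ¬ Adj G u v
  ; sym    = λ { (u≢v , ¬a) → (λ e → u≢v (symm e)) , (λ a → ¬a (Graph.sym G a)) }
  ; irrefl = λ { (v≢v , _) → v≢v refl' }
  }
  where
    open import Relation.Binary.PropositionalEquality
      renaming (sym to symm; refl to refl')

IsColoring : ∀ {n} → Graph n → (Fin n → ℕ) → Set
IsColoring G c = ∀ {u v} → Adj G u v → c u ≢ c v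

IsDominating : ∀ {n} → Graph n → Subset n → Set
IsDominating G D = ∀ v → v ∉ D → ∃ λ d → d ∈ D × Adj G v d

IsUpColorDominating : ∀ {n} → Graph n → (Fin n → ℕ) → Subset n → Set
IsUpColorDominating G c D =
  (∀ v → v ∉ D → ∃ λ d → d ∈ D × Adj G v d × c v < c d) ×
  (∀ d → d ∈ D → c d ≢ 0)

IsDominationNumber : ∀ {n} → Graph n → ℕ → Set
IsDominationNumber {n} G k =
  (∃ λ (D : Subset n) → IsDominating G D × ∣ D ∣ ≡ k) ×
  (∀ (D : Subset n) → IsDominating G D → k ≤ ∣ D ∣)

IsUpColorDominationNumber : ∀ {n} → Graph n → (Fin n → ℕ) → ℕ → Set
IsUpColorDominationNumber {n} G c k =
  (∃ λ (D : Subset n) → IsUpColorDominating G c D × ∣ D ∣ ≡ k) ×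
  (∀ (D : Subset n) → IsUpColorDominating G c D → k ≤ ∣ D ∣)

Colorable : ∀ {n} → Graph n → ℕ → Set
Colorable {n} G k = ∃ λ (f : Fin n → Fin k) → ∀ {u v} → Adj G u v → f u ≢ f v

IsChromaticNumber : ∀ {n} → Graph n → ℕ → Set
IsChromaticNumber G k = Colorable G k × (∀ m → Colorable G m → k ≤ m)

{-# OPTIONS --safe #-}
-- An up-color dominating set is dominating, so γ ≤ γuc.
-- For γuc ≤ χ(Ḡ): the classes of a coloring of Ḡ are cliques of G. In each class
-- take a vertex m of largest c-color; c being proper, every other vertex of the
-- class is adjacent to m with a smaller color, so m up-dominates its class. If
-- c m ≡ 0 the class is just {m}, and m is replaced by a higher-colored neighbour,
-- which exists because some up-color dominating set does (γuc is attained).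
-- Adjacency is an arbitrary type, so "distinct and in the same class ⇒ adjacent"
-- holds only up to double negation; this suffices since γuc ≤ χ̄ is decidable.
module Submission where

open import Defs hiding (sym)
open import Data.Nat using (ℕ; zero; suc; _≤_; _<_; _+_; z≤n; s≤s; _≤?_)
open import Data.Nat.Properties
  using (≤-refl; ≤-reflexive; ≤-trans; ≤-total; +-mono-≤; +-monoʳ-≤; +-suc; n≤1+n; ≤∧≢⇒<; m<n⇒n≢0)
  renaming (_≟_ to _≟ℕ_)
open import Data.Fin using (Fin; zero; suc) renaming (_≟_ to _≟ᶠ_)
open import Data.Fin.Subset using (Subset; _∈_; _∉_; ∣_∣; ⊥; ⁅_⁆; _∪_; inside; outside)
open import Data.Fin.Subset.Properties using (∉⊥; ∣⊥∣≡0; ∣⁅x⁆∣≡1; x∈⁅x⁆; x∈⁅y⁆⇒x≡y; x∈p∪q⁺; x∈p∪q⁻; _∈?_)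
open import Data.Vec using ([]; _∷_)
open import Data.Maybe using (Maybe; just; nothing; maybe′)
import Data.Maybe as Maybe
open import Data.Maybe.Properties using (just-injective; map-just)
open import Data.Product using (∃; _×_; _,_; proj₁; proj₂)
import Data.Product as Product
open import Data.Sum using (_⊎_; inj₁; inj₂; [_,_]′)
open import Function using (_∘_; id; const)
open import Relation.Nullary using (¬_; yes; no)
open import Relation.Nullary.Negation using (contradiction; ¬¬-map)
open import Relation.Nullary.Decidable using (decidable-stable)
open import Relation.Unary using (Decidable; Empty)
open import Relation.Binary.PropositionalEquality using (_≡_; _≢_; refl; sym; cong; subst)

∣p∪q∣≤∣p∣+∣q∣ : ∀ {n} (p q : Subset n) → ∣ p ∪ q ∣ ≤ ∣ p ∣ + ∣ q ∣
∣p∪q∣≤∣p∣+∣q∣ []            []            = z≤n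
∣p∪q∣≤∣p∣+∣q∣ (outside ∷ p) (outside ∷ q) = ∣p∪q∣≤∣p∣+∣q∣ p q
∣p∪q∣≤∣p∣+∣q∣ (outside ∷ p) (inside  ∷ q) =
  ≤-trans (s≤s (∣p∪q∣≤∣p∣+∣q∣ p q)) (≤-reflexive (sym (+-suc ∣ p ∣ ∣ q ∣)))
∣p∪q∣≤∣p∣+∣q∣ (inside  ∷ p) (outside ∷ q) = s≤s (∣p∪q∣≤∣p∣+∣q∣ p q)
∣p∪q∣≤∣p∣+∣q∣ (inside  ∷ p) (inside  ∷ q) =
  s≤s (≤-trans (∣p∪q∣≤∣p∣+∣q∣ p q) (+-monoʳ-≤ ∣ p ∣ (n≤1+n ∣ q ∣)))

maybe⁅_⁆ : ∀ {n} → Maybe (Fin n) → Subset n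
maybe⁅_⁆ = maybe′ ⁅_⁆ ⊥

∣maybe⁅x⁆∣≤1 : ∀ {n} (x : Maybe (Fin n)) → ∣ maybe⁅ x ⁆ ∣ ≤ 1
∣maybe⁅x⁆∣≤1 (just x) = ≤-reflexive (∣⁅x⁆∣≡1 x)
∣maybe⁅x⁆∣≤1 {n} nothing = ≤-trans (≤-reflexive (∣⊥∣≡0 n)) z≤n

x∈maybe⁅y⁆⇒y≡just-x : ∀ {n} {x : Fin n} (y : Maybe (Fin n)) → x ∈ maybe⁅ y ⁆ → y ≡ just x
x∈maybe⁅y⁆⇒y≡just-x (just y) x∈⁅y⁆ = cong just (sym (x∈⁅y⁆⇒x≡y y x∈⁅y⁆))
x∈maybe⁅y⁆⇒y≡just-x nothing  x∈⊥   = contradiction x∈⊥ ∉⊥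

image : ∀ {k n} → (Fin k → Maybe (Fin n)) → Subset n
image {zero}  g = ⊥
image {suc k} g = maybe⁅ g zero ⁆ ∪ image (g ∘ suc)

∣image∣≤k : ∀ {k n} (g : Fin k → Maybe (Fin n)) → ∣ image g ∣ ≤ k
∣image∣≤k {zero} {n} g = ≤-reflexive (∣⊥∣≡0 n)
∣image∣≤k {suc k} g = ≤-trans (∣p∪q∣≤∣p∣+∣q∣ maybe⁅ g zero ⁆ (image (g ∘ suc)))
                              (+-mono-≤ (∣maybe⁅x⁆∣≤1 (g zero)) (∣image∣≤k (g ∘ suc)))

∈image⁺ : ∀ {k n} {g : Fin k → Maybe (Fin n)} {x} i → g i ≡ just x → x ∈ image g
∈image⁺ {x = x} zero    gi≡x =
  x∈p∪q⁺ (inj₁ (subst (λ y → x ∈ maybe⁅ y ⁆) (sym gi≡x) (x∈⁅x⁆ x)))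
∈image⁺         (suc i) gi≡x = x∈p∪q⁺ (inj₂ (∈image⁺ i gi≡x))

∈image⁻ : ∀ {k n} (g : Fin k → Maybe (Fin n)) {x} → x ∈ image g → ∃ λ i → g i ≡ just x
∈image⁻ {zero}  g x∈⊥ = contradiction x∈⊥ ∉⊥
∈image⁻ {suc k} g x∈g with x∈p∪q⁻ maybe⁅ g zero ⁆ (image (g ∘ suc)) x∈g
... | inj₁ x∈head = zero , x∈maybe⁅y⁆⇒y≡just-x (g zero) x∈head
... | inj₂ x∈tail = Product.map suc id (∈image⁻ (g ∘ suc) x∈tail)

IsArgmax : ∀ {n} → (Fin n → Set) → (Fin n → ℕ) → Fin n → Set
IsArgmax P w m = P m × (∀ v → P v → w v ≤ w m)

argmax⊎empty : ∀ {n} {P : Fin n → Set} → Decidable P → (w : Fin n → ℕ) →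
               ∃ (IsArgmax P w) ⊎ Empty P
argmax⊎empty {zero}      P? w = inj₂ λ ()
argmax⊎empty {suc n} {P} P? w with argmax⊎empty {P = P ∘ suc} (P? ∘ suc) (w ∘ suc) | P? zero
... | inj₂ tail-empty  | no ¬p0 = inj₂ λ { zero → ¬p0 ; (suc v) → tail-empty v }
... | inj₂ tail-empty  | yes p0 =
  inj₁ (zero , p0 , λ { zero _ → ≤-refl ; (suc v) pv → contradiction pv (tail-empty v) })
... | inj₁ (m , pm , max) | no ¬p0 =
  inj₁ (suc m , pm , λ { zero p0 → contradiction p0 ¬p0 ; (suc v) → max v })
... | inj₁ (m , pm , max) | yes p0 with ≤-total (w zero) (w (suc m))
...   | inj₁ w0≤wm = inj₁ (suc m , pm , λ { zero _ → w0≤wm ; (suc v) → max v })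
...   | inj₂ wm≤w0 = inj₁ (zero , p0 , λ { zero _ → ≤-refl ; (suc v) pv → ≤-trans (max v pv) wm≤w0 })

¬¬-∀ : ∀ {n} {P : Fin n → Set} → (∀ i → ¬ ¬ P i) → ¬ ¬ (∀ i → P i)
¬¬-∀ {zero}      ¬¬P ¬∀P = ¬∀P λ ()
¬¬-∀ {suc n} {P} ¬¬P ¬∀P =
  ¬¬P zero λ p0 → ¬¬-∀ {P = P ∘ suc} (¬¬P ∘ suc) λ ps → ¬∀P λ { zero → p0 ; (suc i) → ps i }

UpDominated : ∀ {n} → Graph n → (Fin n → ℕ) → Subset n → Fin n → Set
UpDominated G c D v = ∃ λ d → d ∈ D × Adj G v d × c v < c d

upColorDominating⇒dominating : ∀ {n} {G : Graph n} {c : Fin n → ℕ} {D : Subset n} →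
                               IsUpColorDominating G c D → IsDominating G D
upColorDominating⇒dominating (up-dom , _) v v∉D =
  Product.map₂ (Product.map₂ proj₁) (up-dom v v∉D)

color0⇒upDominated : ∀ {n} {G : Graph n} {c : Fin n → ℕ} {D : Subset n} →
                     IsUpColorDominating G c D → ∀ {v} → c v ≡ 0 → UpDominated G c D v
color0⇒upDominated {D = D} (up-dom , nonzero) {v} cv≡0 with v ∈? D
... | yes v∈D = contradiction cv≡0 (nonzero v v∈D)
... | no  v∉D = up-dom v v∉D

sameComplementColor⇒¬¬Adj : ∀ {n k} {G : Graph n} (f : Fin n → Fin k) →
                             (∀ {u v} → Adj (complement G) u v → f u ≢ f v) →
                             ∀ {u v} → f u ≡ f v → u ≢ v → ¬ ¬ Adj G u v
sameComplementColor⇒¬¬Adj f proper fu≡fv u≢v ¬adj = proper (u≢v , ¬adj) fu≡fv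

module ClassRepresentatives {n k} (G : Graph n) (c : Fin n → ℕ) (col : IsColoring G c)
  {D₀ : Subset n} (D₀-ucd : IsUpColorDominating G c D₀)
  (f : Fin n → Fin k) (f-proper : ∀ {u v} → Adj (complement G) u v → f u ≢ f v) where

  upNeighbour : ∀ {m} → c m ≡ 0 → UpDominated G c D₀ m
  upNeighbour = color0⇒upDominated {G = G} D₀-ucd

  raise : Fin n → Fin n
  raise m with c m ≟ℕ 0
  ... | yes cm≡0 = proj₁ (upNeighbour cm≡0)
  ... | no  _    = m

  raise-nonzero : ∀ m → c (raise m) ≢ 0
  raise-nonzero m with c m ≟ℕ 0
  ... | yes cm≡0 = let d , d∈D₀ , _ = upNeighbour cm≡0 in proj₂ D₀-ucd d d∈D₀
  ... | no  cm≢0 = cm≢0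

  raise-fixes-nonzero : ∀ {m} → c m ≢ 0 → raise m ≡ m
  raise-fixes-nonzero {m} cm≢0 with c m ≟ℕ 0
  ... | yes cm≡0 = contradiction cm≡0 cm≢0
  ... | no  _    = refl

  raise-upDominates-0 : ∀ {m} → c m ≡ 0 → Adj G m (raise m) × c m < c (raise m)
  raise-upDominates-0 {m} cm≡0 with c m ≟ℕ 0
  ... | yes cm≡0 = let _ , _ , m~d , cm<cd = upNeighbour cm≡0 in m~d , cm<cd
  ... | no  cm≢0 = contradiction cm≡0 cm≢0

  classTop : Fin k → Maybe (Fin n)
  classTop i = [ just ∘ proj₁ , const nothing ]′ (argmax⊎empty (λ u → f u ≟ᶠ i) c)

  classTop-maximal : ∀ v → ∃ λ m → classTop (f v) ≡ just m × f m ≡ f v × c v ≤ c m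
  classTop-maximal v with argmax⊎empty (λ u → f u ≟ᶠ f v) c
  ... | inj₁ (m , fm≡fv , max) = m , refl , fm≡fv , max v refl
  ... | inj₂ empty             = contradiction refl (empty v)

  D : Subset n
  D = image (Maybe.map raise ∘ classTop)

  raise-classTop∈D : ∀ {i m} → classTop i ≡ just m → raise m ∈ D
  raise-classTop∈D {i} top≡m = ∈image⁺ i (map-just top≡m)

  classTop∈D : ∀ {i m} → classTop i ≡ just m → c m ≢ 0 → m ∈ D
  classTop∈D top≡m cm≢0 = subst (_∈ D) (raise-fixes-nonzero cm≢0) (raise-classTop∈D top≡m)

  D-nonzero : ∀ d → d ∈ D → c d ≢ 0
  D-nonzero d d∈D with ∈image⁻ (Maybe.map raise ∘ classTop) d∈D
  ... | i , rep≡d with classTop i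
  ...   | just m  = subst (λ x → c x ≢ 0) (just-injective rep≡d) (raise-nonzero m)
  ...   | nothing = contradiction rep≡d λ ()

  classTop-upDominated : ∀ {m} → classTop (f m) ≡ just m → m ∉ D → UpDominated G c D m
  classTop-upDominated {m} top≡m m∉D with c m ≟ℕ 0
  ... | yes cm≡0 = raise m , raise-classTop∈D top≡m , raise-upDominates-0 cm≡0
  ... | no  cm≢0 = contradiction (classTop∈D top≡m cm≢0) m∉D

  classmate-upDominated : ∀ {v m} → classTop (f v) ≡ just m → c v ≤ c m → Adj G v m →
                          UpDominated G c D v
  classmate-upDominated top≡m cv≤cm v~m = _ , classTop∈D top≡m (m<n⇒n≢0 cv<cm) , v~m , cv<cm
    where cv<cm = ≤∧≢⇒< cv≤cm (col v~m)

  D-upDominates : ∀ v → ¬ ¬ (v ∉ D → UpDominated G c D v)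
  D-upDominates v with classTop-maximal v
  ... | m , top≡m , fm≡fv , cv≤cm with v ≟ᶠ m
  ...   | yes refl = λ ¬goal → ¬goal (classTop-upDominated top≡m)
  ...   | no  v≢m  = ¬¬-map (λ v~m _ → classmate-upDominated top≡m cv≤cm v~m)
                            (sameComplementColor⇒¬¬Adj {G = G} f f-proper (sym fm≡fv) v≢m)

  D-upColorDominating : ¬ ¬ IsUpColorDominating G c D
  D-upColorDominating = ¬¬-map (_, D-nonzero) (¬¬-∀ D-upDominates)

complementColorable⇒¬¬smallUpColorDominating :
  ∀ {n k} (G : Graph n) (c : Fin n → ℕ) → IsColoring G c →
  (∃ λ D₀ → IsUpColorDominating G c D₀) → Colorable (complement G) k →
  ¬ ¬ ∃ λ D → IsUpColorDominating G c D × ∣ D ∣ ≤ k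
complementColorable⇒¬¬smallUpColorDominating G c col (_ , D₀-ucd) (f , f-proper) =
  ¬¬-map (λ D-ucd → D , D-ucd , ∣image∣≤k _) D-upColorDominating
  where open ClassRepresentatives G c col D₀-ucd f f-proper

proposition2 : ∀ {n} (G : Graph n) (c : Fin n → ℕ) → IsColoring G c →
    ∀ (γ γuc χ̄ : ℕ) →
    IsDominationNumber G γ →
    IsUpColorDominationNumber G c γuc →
    IsChromaticNumber (complement G) χ̄ →
    γ ≤ γuc × γuc ≤ χ̄
proposition2 G c col γ γuc χ̄ (_ , γ-min) ((D₀ , D₀-ucd , ∣D₀∣≡γuc) , γuc-min) (χ̄-coloring , _) =
  subst (γ ≤_) ∣D₀∣≡γuc (γ-min D₀ (upColorDominating⇒dominating {G = G} D₀-ucd)) ,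
  decidable-stable (γuc ≤? χ̄)
    (¬¬-map (λ (D , D-ucd , ∣D∣≤χ̄) → ≤-trans (γuc-min D D-ucd) ∣D∣≤χ̄)
            (complementColorable⇒¬¬smallUpColorDominating G c col (D₀ , D₀-ucd) χ̄-coloring))
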